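{- Let $E$ be a low-defect expression with low-defect tree $T$ (root $v_0$) and low-defect polynomial $f$, and for each non-root vertex $v$ let $x_v$ be the variable of $E$ corresponding to $v$. Then for a subset $S$ of $V(T)\setminus\{v_0\}$, the monomial $\prod_{v\in S}x_v$ appears in $f$ with nonzero coefficient if and only if the subgraph of $T$ induced by $S\cup\{v_0\}$ is a subtree (i.e. is connected). In that case its coefficient is \[ \Big(\prod_{v\in S\cup\{v_0\}}w(v)\Big)\Big(\prod_{e\text{ with exactly one endpoint in }S\cup\{v_0\}}w(e)\Big), \] where $w$ denotes labels. The constant term corresponds to the subtree $\{v_0\}$ and the leading term to all of $T$.
   Context: Low-defect expressions: (a) every positive integer constant is one; (b) the product of two low-defect expressions with disjoint variable sets is one; (c) if $E$ is one, $c$ a positive integer and $x$ a variable not in $E$, then $E\cdot x+c$ is one. Evaluating $E$ gives a polynomial $f$ (its low-defect polynomial). The low-defect tree $T$ of $E$ is a rooted tree with vertices and edges labeled by positive integers, built recursively: if $E$ is a constant $n$, $T$ is a single vertex labeled $n$; if $E=E'\cdot x+c$ with tree $T'$, then $T$ is $T'$ with a new root labeled $1$ joined to the root of $T'$ by an edge labeled $c$; if $E=E_1\cdot E_2$ with trees $T_1,T_2$, then $T$ is obtained by removing the roots of $T_1,T_2$ and adding a new root, labeled by the product of the two old root labels, adjacent to all vertices previously adjacent to either old root, with edge labels kept. Correspondence of variables to non-root vertices: for a constant there is nothing; for $E=E'\cdot x+c$, the variables of $E'$ correspond as in $T'$ and $x$ corresponds to the root of $T'$; for $E=E_1\cdot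 E_2$, variables of each $E_j$ correspond as in $T_j$. This is a bijection between variables of $E$ and non-root vertices of $T$. -}

module Defs where

open import Data.Nat using (ℕ; zero; suc; _+_; _*_; _≤_)
open import Data.Bool using (Bool; true; false; if_then_else_; _xor_)
open import Data.Fin using (Fin)
open import Data.Fin.Properties using () renaming (_≟_ to _≟ᶠ_)
open import Data.Maybe using (Maybe; just; nothing)
open import Data.Product using (_×_; _,_; ∃; proj₁; proj₂)
open import Data.Sum using (_⊎_)
open import Data.List using (List; []; _∷_; _++_; map; concatMap; filterᵇ)
open import Data.Nat.ListAction using (sum; product)
open import Data.List.Membership.Propositional using (_∈_; _∉_)
open import Data.Vec using (Vec; lookup; replicate; zipWith; updateAt)
import Data.Vec.Properties as VecP
import Data.Nat as N
open import Relation.Nullary.Decidable using (⌊_⌋)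
open import Relation.Binary.PropositionalEquality using (_≡_)

data LDE (n : ℕ) : Set where
  const : ℕ → LDE n
  mul   : LDE n → LDE n → LDE n
  lin   : LDE n → Fin n → ℕ → LDE n          -- lin E x c  =  E · x + c

vars : ∀ {n} → LDE n → List (Fin n)
vars (const _)   = []
vars (mul a b)   = vars a ++ vars b
vars (lin e x c) = x ∷ vars e

data WellFormed {n : ℕ} : LDE n → Set where
  const : ∀ {k} → 1 ≤ k → WellFormed (const k)
  mul   : ∀ {a b} → WellFormed a → WellFormed b →
          (∀ x → x ∈ vars a → x ∉ vars b) → WellFormed (mul a b)
  lin   : ∀ {e x c} → WellFormed e → x ∉ vars e → 1 ≤ c →
          WellFormed (lin e x c)

-- Polynomials in x₀ … x_{n-1} with ℕ coefficients, as (unnormalised)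
-- lists of terms  (coefficient , exponent vector).

Mono : ℕ → Set
Mono n = Vec ℕ n

Poly : ℕ → Set
Poly n = List (ℕ × Mono n)

one : ∀ {n} → Mono n
one = replicate _ 0

varMono : ∀ {n} → Fin n → Mono n
varMono x = updateAt one x (λ _ → 1)

monoMul : ∀ {n} → Mono n → Mono n → Mono n
monoMul = zipWith _+_

polyMul : ∀ {n} → Poly n → Poly n → Poly n
polyMul p q = concatMap (λ t → map (λ s → (proj₁ t * proj₁ s , monoMul (proj₂ t) (proj₂ s))) q) p

eval : ∀ {n} → LDE n → Poly n
eval (const k)   = (k , one) ∷ []
eval (mul a b)   = polyMul (eval a) (eval b)
eval (lin e x c) = polyMul (eval e) ((1 , varMono x) ∷ []) ++ ((c , one) ∷ [])

coeff : ∀ {n} → Poly n → Mono n → ℕ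
coeff p m = sum (map proj₁ (filterᵇ (λ t → ⌊ VecP.≡-dec N._≟_ (proj₂ t) m ⌋) p))

-- Low-defect trees.  A node carries its label and its list of children;
-- each child is given with the label of the edge to it and the variable
-- corresponding to that (non-root) vertex.

data Tree (n : ℕ) : Set where
  node : ℕ → List (ℕ × Fin n × Tree n) → Tree n

merge : ∀ {n} → Tree n → Tree n → Tree n
merge (node k cs) (node l ds) = node (k * l) (cs ++ ds)

tree : ∀ {n} → LDE n → Tree n
tree (const k)   = node k []
tree (mul a b)   = merge (tree a) (tree b)
tree (lin e x c) = node 1 ((c , x , tree e) ∷ [])

-- Vertices of T: the root is `nothing`, the vertex corresponding to
-- variable x is `just x`.
Vertex : ℕ → Set
Vertex n = Maybe (Fin n)

-- Edges as (parent , edge label , child).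
Edge : ℕ → Set
Edge n = Vertex n × ℕ × Vertex n

mutual
  edgesT : ∀ {n} → Vertex n → Tree n → List (Edge n)
  edgesT p (node _ cs) = edgesL p cs

  edgesL : ∀ {n} → Vertex n → List (ℕ × Fin n × Tree n) → List (Edge n)
  edgesL p []                = []
  edgesL p ((c , x , t) ∷ cs) = (p , c , just x) ∷ (edgesT (just x) t ++ edgesL p cs)

mutual
  vertsT : ∀ {n} → Vertex n → Tree n → List (Vertex n × ℕ)
  vertsT v (node k cs) = (v , k) ∷ vertsL cs

  vertsL : ∀ {n} → List (ℕ × Fin n × Tree n) → List (Vertex n × ℕ)
  vertsL []                = []
  vertsL ((c , x , t) ∷ cs) = vertsT (just x) t ++ vertsL cs

edges : ∀ {n} → Tree n → List (Edge n)
edges = edgesT nothing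

verts : ∀ {n} → Tree n → List (Vertex n × ℕ)
verts = vertsT nothing

Adj : ∀ {n} → Tree n → Vertex n → Vertex n → Set
Adj T u v = ∃ λ c → ((u , c , v) ∈ edges T) ⊎ ((v , c , u) ∈ edges T)

-- Subsets S of the variables (= non-root vertices), and S ∪ {v₀}.

Subset : ℕ → Set
Subset n = Vec Bool n

inU : ∀ {n} → Subset n → Vertex n → Bool
inU S nothing  = true
inU S (just x) = lookup S x

monoOf : ∀ {n} → Subset n → Mono n
monoOf S = Data.Vec.map (λ b → if b then 1 else 0) S

data Walk {n : ℕ} (T : Tree n) (S : Subset n) : Vertex n → Vertex n → Set where
  done : ∀ {u} → Walk T S u u
  step : ∀ {u v w} → Adj T u v → inU S v ≡ true → Walk T S v w → Walk T S u w

InducedConnected : ∀ {n} → Tree n → Subset n → Set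
InducedConnected T S =
  ∀ u v → inU S u ≡ true → inU S v ≡ true → Walk T S u v

coeffFormula : ∀ {n} → Tree n → Subset n → ℕ
coeffFormula T S =
  product (map proj₂ (filterᵇ (λ p → inU S (proj₁ p)) (verts T)))
  * product (map (λ e → proj₁ (proj₂ e))
      (filterᵇ (λ e → inU S (proj₁ e) xor inU S (proj₂ (proj₂ e))) (edges T)))

module Submission where

-- The coefficient of x^S can be computed along the expression: factors of a
-- product have disjoint variables, so their coefficients multiply; the coefficient of x^S in
-- E·x + c is that of x^(S∖{x}) in E when x ∈ S, and otherwise c or 0 according as S does or
-- does not miss the variables of E.  This recursion is nonzero exactly when S ∪ {v₀} is a
-- subtree of T grown from the root (positivity of the constants), and that is connectivity: a
-- walk from the root to a vertex below x must pass through x.  On such a subtree the same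
-- recursion unfolds to the product of the vertex labels in S ∪ {v₀} and of the labels of the
-- boundary edges, the edge labelled c being a boundary edge exactly when x ∉ S.

open import Defs
open import Data.Bool using (Bool; true; false; if_then_else_; _xor_; _∧_; _∨_; T?)
open import Data.Bool.ListAction using (any)
open import Data.Bool.Properties using (¬-not)
open import Data.Empty using (⊥; ⊥-elim)
open import Data.Fin using (Fin)
import Data.Fin.Properties as Fin
open import Data.List using (List; []; _∷_; _++_; [_]; map; filterᵇ)
open import Data.List.Membership.Propositional using (_∈_; _∉_)
open import Data.List.Membership.Propositional.Properties using (∈-++⁺ˡ; ∈-++⁺ʳ; ∈-++⁻)
open import Data.List.Properties using (map-++; filter-++; ++-identityʳ; ++-assoc)
open import Data.List.Relation.Binary.Subset.Propositional using (_⊆_)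
open import Data.List.Relation.Unary.All as All using (All; []; _∷_)
open import Data.List.Relation.Unary.All.Properties using (++⁺; map⁺)
open import Data.List.Relation.Unary.Any using (here; there; any?)
import Data.List.Relation.Unary.Any.Properties as Any
open import Data.Maybe using (just; nothing)
open import Data.Nat using (ℕ; _+_; _*_)
import Data.Nat as ℕ
open import Data.Nat.ListAction using (sum; product)
open import Data.Nat.ListAction.Properties using (sum-++; product-++)
open import Data.Nat.Properties
open import Algebra.Properties.CommutativeSemigroup *-commutativeSemigroup using (interchange; x∙yz≈y∙xz)
open import Data.Product using (∃₂; _×_; _,_; proj₁; proj₂)
open import Data.Sum using (_⊎_; inj₁; inj₂; [_,_]′; map₂) renaming (map to map-⊎)
open import Data.Vec using (lookup; tabulate)
import Data.Vec.Properties as Vec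
open import Data.Vec.Relation.Binary.Pointwise.Extensional using (ext; Pointwise-≡⇒≡)
open import Function using (_∘_)
open import Relation.Binary.PropositionalEquality hiding ([_])
open import Relation.Nullary using (Dec; yes; no; ¬_; contradiction)
open import Relation.Nullary.Decidable using (⌊_⌋)
open import Relation.Unary using (Decidable)

private variable n : ℕ

_∈?_ : (y : Fin n) (A : List (Fin n)) → Dec (y ∈ A)
y ∈? A = any? (y Fin.≟_) A

_≟ᵐ_ : (u m : Mono n) → Dec (u ≡ m)
_≟ᵐ_ = Vec.≡-dec ℕ._≟_

any-false⁺ : ∀ {A : Set} (p : A → Bool) {xs} → (∀ {x} → x ∈ xs → p x ≡ false) → any p xs ≡ false
any-false⁺ p {[]}     _   = refl
any-false⁺ p {x ∷ xs} all rewrite all (here refl) = any-false⁺ p (all ∘ there)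

any-false⁻ : ∀ {A : Set} (p : A → Bool) {xs x} → any p xs ≡ false → x ∈ xs → p x ≡ false
any-false⁻ p {y ∷ xs} eq (here refl) with p y
... | false = refl
any-false⁻ p {y ∷ xs} eq (there x∈xs) with p y
... | false = any-false⁻ p eq x∈xs

any-cong : ∀ {A : Set} {p q : A → Bool} {xs} → (∀ {x} → x ∈ xs → p x ≡ q x) → any p xs ≡ any q xs
any-cong {xs = []}     _  = refl
any-cong {xs = x ∷ xs} eq = cong₂ _∨_ (eq (here refl)) (any-cong (eq ∘ there))

termCoeff : ℕ × Mono n → Mono n → ℕ
termCoeff (c , u) m = if ⌊ u ≟ᵐ m ⌋ then c else 0

termCoeff-≡ : ∀ {c} {u m : Mono n} → u ≡ m → termCoeff (c , u) m ≡ c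
termCoeff-≡ {u = u} {m} u≡m with u ≟ᵐ m
... | yes _   = refl
... | no u≢m = contradiction u≡m u≢m

termCoeff-≢ : ∀ {c} {u m : Mono n} → u ≢ m → termCoeff (c , u) m ≡ 0
termCoeff-≢ {u = u} {m} u≢m with u ≟ᵐ m
... | yes u≡m = contradiction u≡m u≢m
... | no _    = refl

coeff-∷ : ∀ (t : ℕ × Mono n) p m → coeff (t ∷ p) m ≡ termCoeff t m + coeff p m
coeff-∷ (c , u) p m with u ≟ᵐ m
... | yes _ = refl
... | no _  = refl

coeff-[_] : ∀ (t : ℕ × Mono n) m → coeff [ t ] m ≡ termCoeff t m
coeff-[ t ] m = trans (coeff-∷ t [] m) (+-identityʳ _)

coeff-++ : ∀ (p q : Poly n) m → coeff (p ++ q) m ≡ coeff p m + coeff q m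
coeff-++ p q m = begin
  sum (map proj₁ (filterᵇ matches (p ++ q)))
    ≡⟨ cong (sum ∘ map proj₁) (filter-++ (T? ∘ matches) p q) ⟩
  sum (map proj₁ (filterᵇ matches p ++ filterᵇ matches q))
    ≡⟨ cong sum (map-++ proj₁ (filterᵇ matches p) (filterᵇ matches q)) ⟩
  sum (map proj₁ (filterᵇ matches p) ++ map proj₁ (filterᵇ matches q))
    ≡⟨ sum-++ (map proj₁ (filterᵇ matches p)) (map proj₁ (filterᵇ matches q)) ⟩
  coeff p m + coeff q m ∎
  where
  open ≡-Reasoning
  matches : ℕ × Mono _ → Bool
  matches t = ⌊ proj₂ t ≟ᵐ m ⌋

termMul : ℕ × Mono n → Poly n → Poly n
termMul (c , u) = map (λ s → (c * proj₁ s , monoMul u (proj₂ s)))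

record SupportedOn (A : List (Fin n)) (m : Mono n) : Set where
  constructor vanishes-outside
  field vanishes : ∀ {y} → y ∉ A → lookup m y ≡ 0
open SupportedOn

PolySupportedOn : List (Fin n) → Poly n → Set
PolySupportedOn A = All (SupportedOn A ∘ proj₂)

Disjoint : List (Fin n) → List (Fin n) → Set
Disjoint A B = ∀ y → y ∈ A → y ∉ B

Disjoint-sym : ∀ {A B : List (Fin n)} → Disjoint A B → Disjoint B A
Disjoint-sym A#B y y∈B y∈A = A#B y y∈A y∈B

lookup-monoMul : ∀ (u w : Mono n) y → lookup (monoMul u w) y ≡ lookup u y + lookup w y
lookup-monoMul u w y = Vec.lookup-zipWith _+_ y u w

lookup-one : ∀ (y : Fin n) → lookup one y ≡ 0
lookup-one y = Vec.lookup-replicate y 0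

one-supported : ∀ {A : List (Fin n)} → SupportedOn A one
one-supported = vanishes-outside λ {y} _ → lookup-one y

varMono-supported : ∀ (x : Fin n) → SupportedOn [ x ] (varMono x)
varMono-supported x = vanishes-outside λ {y} y∉[x] →
  trans (Vec.lookup∘updateAt′ y x (y∉[x] ∘ here) one) (lookup-one y)

monoMul-supported : ∀ {A B : List (Fin n)} {u w} → SupportedOn A u → SupportedOn B w →
                    SupportedOn (A ++ B) (monoMul u w)
monoMul-supported {A = A} {u = u} {w} su sw = vanishes-outside λ {y} y∉A++B → begin
  lookup (monoMul u w) y
    ≡⟨ lookup-monoMul u w y ⟩
  lookup u y + lookup w y
    ≡⟨ cong₂ _+_ (vanishes su (y∉A++B ∘ ∈-++⁺ˡ)) (vanishes sw (y∉A++B ∘ ∈-++⁺ʳ A)) ⟩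
  0 ∎
  where open ≡-Reasoning

polyMul-supported : ∀ {A B : List (Fin n)} {p q} → PolySupportedOn A p → PolySupportedOn B q →
                    PolySupportedOn (A ++ B) (polyMul p q)
polyMul-supported []        sq = []
polyMul-supported (su ∷ sp) sq = ++⁺ (map⁺ (All.map (monoMul-supported su) sq)) (polyMul-supported sp sq)

eval-supported : ∀ (E : LDE n) → PolySupportedOn (vars E) (eval E)
eval-supported (const k)   = one-supported ∷ []
eval-supported (mul a b)   = polyMul-supported (eval-supported a) (eval-supported b)
eval-supported (lin e x c) =
  ++⁺ (All.map reorder (polyMul-supported (eval-supported e) (varMono-supported x ∷ []))) (one-supported ∷ [])
  where
  reorder : ∀ {m} → SupportedOn (vars e ++ [ x ]) m → SupportedOn (x ∷ vars e) m
  reorder s = vanishes-outside λ y∉ → vanishes s (y∉ ∘ Any.++-comm (vars e) [ x ])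

monoMul-injective : ∀ {A B : List (Fin n)} {u w u′ w′} →
  SupportedOn A u → SupportedOn B w → SupportedOn A u′ → SupportedOn B w′ → Disjoint A B →
  monoMul u w ≡ monoMul u′ w′ → u ≡ u′ × w ≡ w′
monoMul-injective {A = A} {u = u} {w} {u′} {w′} su sw su′ sw′ A#B eq =
  Pointwise-≡⇒≡ (ext first) , Pointwise-≡⇒≡ (ext second)
  where
  sums : ∀ y → lookup u y + lookup w y ≡ lookup u′ y + lookup w′ y
  sums y = trans (sym (lookup-monoMul u w y)) (trans (cong (λ v → lookup v y) eq) (lookup-monoMul u′ w′ y))
  first : ∀ y → lookup u y ≡ lookup u′ y
  first y with y ∈? A
  ... | no y∉A  = trans (vanishes su y∉A) (sym (vanishes su′ y∉A))
  ... | yes y∈A = +-cancelʳ-≡ 0 (lookup u y) (lookup u′ y)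
    (subst₂ (λ i j → lookup u y + i ≡ lookup u′ y + j)
            (vanishes sw (A#B y y∈A)) (vanishes sw′ (A#B y y∈A)) (sums y))
  second : ∀ y → lookup w y ≡ lookup w′ y
  second y = +-cancelˡ-≡ (lookup u y) (lookup w y) (lookup w′ y)
    (trans (sums y) (cong (_+ lookup w′ y) (sym (first y))))

termCoeff-monoMul : ∀ {A B : List (Fin n)} {c d u w mA mB} →
  SupportedOn A u → SupportedOn B w → SupportedOn A mA → SupportedOn B mB → Disjoint A B →
  termCoeff (c * d , monoMul u w) (monoMul mA mB) ≡ termCoeff (c , u) mA * termCoeff (d , w) mB
termCoeff-monoMul {c = c} {d} {u} {w} {mA} {mB} su sw sA sB A#B with u ≟ᵐ mA | w ≟ᵐ mB
... | yes refl | yes refl = termCoeff-≡ {c = c * d} refl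
... | yes _    | no w≢mB  = trans (termCoeff-≢ (w≢mB ∘ proj₂ ∘ monoMul-injective su sw sA sB A#B))
                                  (sym (*-zeroʳ c))
... | no u≢mA  | _        = termCoeff-≢ (u≢mA ∘ proj₁ ∘ monoMul-injective su sw sA sB A#B)

coeff-termMul : ∀ {A B : List (Fin n)} {u mA mB} c (q : Poly n) →
  SupportedOn A u → PolySupportedOn B q → SupportedOn A mA → SupportedOn B mB → Disjoint A B →
  coeff (termMul (c , u) q) (monoMul mA mB) ≡ termCoeff (c , u) mA * coeff q mB
coeff-termMul {u = u} {mA} c [] su [] sA sB A#B = sym (*-zeroʳ (termCoeff (c , u) mA))
coeff-termMul {u = u} {mA} {mB} c ((d , w) ∷ q) su (sw ∷ sq) sA sB A#B = begin
  coeff (termMul (c , u) ((d , w) ∷ q)) (monoMul mA mB)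
    ≡⟨ coeff-∷ (c * d , monoMul u w) (termMul (c , u) q) (monoMul mA mB) ⟩
  termCoeff (c * d , monoMul u w) (monoMul mA mB) + coeff (termMul (c , u) q) (monoMul mA mB)
    ≡⟨ cong₂ _+_ (termCoeff-monoMul su sw sA sB A#B) (coeff-termMul c q su sq sA sB A#B) ⟩
  t * termCoeff (d , w) mB + t * coeff q mB  ≡⟨ *-distribˡ-+ t _ _ ⟨
  t * (termCoeff (d , w) mB + coeff q mB)    ≡⟨ cong (t *_) (coeff-∷ (d , w) q mB) ⟨
  t * coeff ((d , w) ∷ q) mB                 ∎
  where
  open ≡-Reasoning
  t = termCoeff (c , u) mA

coeff-polyMul : ∀ {A B : List (Fin n)} {mA mB} (p q : Poly n) →
  PolySupportedOn A p → PolySupportedOn B q → SupportedOn A mA → SupportedOn B mB → Disjoint A B →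
  coeff (polyMul p q) (monoMul mA mB) ≡ coeff p mA * coeff q mB
coeff-polyMul [] q [] sq sA sB A#B = refl
coeff-polyMul {mA = mA} {mB} ((c , u) ∷ p) q (su ∷ sp) sq sA sB A#B = begin
  coeff (termMul (c , u) q ++ polyMul p q) (monoMul mA mB)
    ≡⟨ coeff-++ (termMul (c , u) q) (polyMul p q) (monoMul mA mB) ⟩
  coeff (termMul (c , u) q) (monoMul mA mB) + coeff (polyMul p q) (monoMul mA mB)
    ≡⟨ cong₂ _+_ (coeff-termMul c q su sq sA sB A#B) (coeff-polyMul p q sp sq sA sB A#B) ⟩
  termCoeff (c , u) mA * coeff q mB + coeff p mA * coeff q mB
    ≡⟨ *-distribʳ-+ (coeff q mB) (termCoeff (c , u) mA) _ ⟨
  (termCoeff (c , u) mA + coeff p mA) * coeff q mB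
    ≡⟨ cong (_* coeff q mB) (coeff-∷ (c , u) p mA) ⟨
  coeff ((c , u) ∷ p) mA * coeff q mB ∎
  where open ≡-Reasoning

_⊆ˢ_ : Subset n → List (Fin n) → Set
S ⊆ˢ A = ∀ y → lookup S y ≡ true → y ∈ A

Empty : Subset n → Set
Empty S = ∀ y → lookup S y ≡ false

false-outside : ∀ {S : Subset n} {A y} → S ⊆ˢ A → y ∉ A → lookup S y ≡ false
false-outside {S = S} {y = y} S⊆A y∉A with lookup S y in Sy
... | true  = contradiction (S⊆A y Sy) y∉A
... | false = refl

_∩_ : Subset n → List (Fin n) → Subset n
S ∩ A = tabulate (λ y → ⌊ y ∈? A ⌋ ∧ lookup S y)

lookup-∩-∈ : ∀ (S : Subset n) {A y} → y ∈ A → lookup (S ∩ A) y ≡ lookup S y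
lookup-∩-∈ S {A} {y} y∈A rewrite Vec.lookup∘tabulate (λ z → ⌊ z ∈? A ⌋ ∧ lookup S z) y with y ∈? A
... | yes _   = refl
... | no y∉A = contradiction y∈A y∉A

lookup-∩-∉ : ∀ (S : Subset n) {A y} → y ∉ A → lookup (S ∩ A) y ≡ false
lookup-∩-∉ S {A} {y} y∉A rewrite Vec.lookup∘tabulate (λ z → ⌊ z ∈? A ⌋ ∧ lookup S z) y with y ∈? A
... | yes y∈A = contradiction y∈A y∉A
... | no _    = refl

∩-⊆ˢ : ∀ (S : Subset n) A → (S ∩ A) ⊆ˢ A
∩-⊆ˢ S A y Sy with y ∈? A
... | yes y∈A = y∈A
... | no y∉A  = contradiction (trans (sym Sy) (lookup-∩-∉ S y∉A)) λ ()

lookup-monoOf : ∀ (S : Subset n) y → lookup (monoOf S) y ≡ (if lookup S y then 1 else 0)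
lookup-monoOf S y = Vec.lookup-map y _ S

monoOf-supported : ∀ {S : Subset n} {A} → S ⊆ˢ A → SupportedOn A (monoOf S)
monoOf-supported {S = S} S⊆A = vanishes-outside λ {y} y∉A →
  trans (lookup-monoOf S y) (cong (λ b → if b then 1 else 0) (false-outside {S = S} S⊆A y∉A))

monoOf-split : ∀ {S : Subset n} {A B} → S ⊆ˢ (A ++ B) → Disjoint A B →
               monoOf S ≡ monoMul (monoOf (S ∩ A)) (monoOf (S ∩ B))
monoOf-split {S = S} {A} {B} S⊆A++B A#B = Pointwise-≡⇒≡ (ext pointwise)
  where
  pointwise : ∀ y → lookup (monoOf S) y ≡ lookup (monoMul (monoOf (S ∩ A)) (monoOf (S ∩ B))) y
  pointwise y rewrite lookup-monoMul (monoOf (S ∩ A)) (monoOf (S ∩ B)) y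
                    | lookup-monoOf S y | lookup-monoOf (S ∩ A) y | lookup-monoOf (S ∩ B) y
    with y ∈? A | y ∈? B
  ... | yes y∈A | _       rewrite lookup-∩-∈ S y∈A | lookup-∩-∉ S (A#B y y∈A) = sym (+-identityʳ _)
  ... | no y∉A  | yes y∈B rewrite lookup-∩-∉ S y∉A | lookup-∩-∈ S y∈B = refl
  ... | no y∉A  | no y∉B  rewrite lookup-∩-∉ S y∉A | lookup-∩-∉ S y∉B =
    cong (λ b → if b then 1 else 0) (false-outside {S = S} S⊆A++B ([ y∉A , y∉B ]′ ∘ ∈-++⁻ A))

coeff-polyMul-monoOf : ∀ {A B : List (Fin n)} {p q S} → PolySupportedOn A p → PolySupportedOn B q →
  Disjoint A B → S ⊆ˢ (A ++ B) →
  coeff (polyMul p q) (monoOf S) ≡ coeff p (monoOf (S ∩ A)) * coeff q (monoOf (S ∩ B))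
coeff-polyMul-monoOf {A = A} {B} {p} {q} {S} sp sq A#B S⊆A++B =
  trans (cong (coeff (polyMul p q)) (monoOf-split S⊆A++B A#B))
        (coeff-polyMul p q sp sq (monoOf-supported (∩-⊆ˢ S A)) (monoOf-supported (∩-⊆ˢ S B)) A#B)

empty⇒monoOf≡one : ∀ {S : Subset n} → Empty S → monoOf S ≡ one
empty⇒monoOf≡one {S = S} empty = Pointwise-≡⇒≡ (ext λ y →
  trans (lookup-monoOf S y) (trans (cong (λ b → if b then 1 else 0) (empty y)) (sym (lookup-one y))))

monoOf≡one⇒empty : ∀ {S : Subset n} → monoOf S ≡ one → Empty S
monoOf≡one⇒empty {S = S} eq y with lookup S y in Sy
... | false = refl
... | true  = contradiction 1≡0 λ ()
  where
  1≡0 : 1 ≡ 0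
  1≡0 = begin
    1                                ≡⟨ cong (λ b → if b then 1 else 0) Sy ⟨
    (if lookup S y then 1 else 0)    ≡⟨ lookup-monoOf S y ⟨
    lookup (monoOf S) y              ≡⟨ cong (λ m → lookup m y) eq ⟩
    lookup one y                     ≡⟨ lookup-one y ⟩
    0                                ∎
    where open ≡-Reasoning

varMono≢one : ∀ (x : Fin n) → varMono x ≢ one
varMono≢one x eq with trans (sym (Vec.lookup∘updateAt x one)) (trans (cong (λ m → lookup m x) eq) (lookup-one x))
... | ()

monoOf-∩-single : ∀ {S : Subset n} {x} → lookup S x ≡ true → monoOf (S ∩ [ x ]) ≡ varMono x
monoOf-∩-single {S = S} {x} Sx = Pointwise-≡⇒≡ (ext pointwise)
  where
  pointwise : ∀ y → lookup (monoOf (S ∩ [ x ])) y ≡ lookup (varMono x) y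
  pointwise y rewrite lookup-monoOf (S ∩ [ x ]) y with y Fin.≟ x
  ... | yes refl rewrite lookup-∩-∈ S {[ x ]} (here refl) | Sx = sym (Vec.lookup∘updateAt x one)
  ... | no y≢x   rewrite lookup-∩-∉ S {[ x ]} (y≢x ∘ Any.singleton⁻) =
    sym (trans (Vec.lookup∘updateAt′ y x y≢x one) (lookup-one y))

coeff-varMono : ∀ (S : Subset n) x →
                coeff [ (1 , varMono x) ] (monoOf (S ∩ [ x ])) ≡ (if lookup S x then 1 else 0)
coeff-varMono S x = trans (coeff-[ 1 , varMono x ] _) (by-cases (lookup S x) refl)
  where
  by-cases : ∀ b → lookup S x ≡ b → termCoeff (1 , varMono x) (monoOf (S ∩ [ x ])) ≡ (if b then 1 else 0)
  by-cases true  Sx = termCoeff-≡ (sym (monoOf-∩-single {S = S} Sx))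
  by-cases false Sx = termCoeff-≢ λ x≡ → varMono≢one x (trans x≡ (empty⇒monoOf≡one empty))
    where
    empty : Empty (S ∩ [ x ])
    empty y with y ∈? [ x ]
    ... | yes (here refl) = trans (lookup-∩-∈ S (here refl)) Sx
    ... | no y∉[x]        = lookup-∩-∉ S y∉[x]

coeff-one : ∀ {S : Subset n} {A} c → S ⊆ˢ A →
            coeff [ (c , one) ] (monoOf S) ≡ (if any (lookup S) A then 0 else c)
coeff-one {S = S} {A} c S⊆A = trans (coeff-[ c , one ] _) (by-cases (any (lookup S) A) refl)
  where
  by-cases : ∀ b → any (lookup S) A ≡ b → termCoeff (c , one) (monoOf S) ≡ (if b then 0 else c)
  by-cases true  hit  = termCoeff-≢ λ one≡ →
    contradiction (trans (sym hit) (any-false⁺ (lookup S) {A} λ {y} _ → monoOf≡one⇒empty (sym one≡) y)) λ ()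
  by-cases false miss = termCoeff-≡ (sym (empty⇒monoOf≡one empty))
    where
    empty : Empty S
    empty y with y ∈? A
    ... | yes y∈A = any-false⁻ (lookup S) miss y∈A
    ... | no y∉A  = false-outside {S = S} S⊆A y∉A

exprCoeff : LDE n → Subset n → ℕ
exprCoeff (const k)   S = k
exprCoeff (mul a b)   S = exprCoeff a S * exprCoeff b S
exprCoeff (lin e x c) S = if lookup S x then exprCoeff e S else (if any (lookup S) (vars e) then 0 else c)

exprCoeff-cong : ∀ (E : LDE n) {S S′} → (∀ {y} → y ∈ vars E → lookup S y ≡ lookup S′ y) →
                 exprCoeff E S ≡ exprCoeff E S′
exprCoeff-cong (const k)   eq = refl
exprCoeff-cong (mul a b)   eq =
  cong₂ _*_ (exprCoeff-cong a (eq ∘ ∈-++⁺ˡ)) (exprCoeff-cong b (eq ∘ ∈-++⁺ʳ (vars a)))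
exprCoeff-cong (lin e x c) {S} {S′} eq
  rewrite exprCoeff-cong e {S} {S′} (eq ∘ there) | eq (here refl)
        | any-cong {p = lookup S} {lookup S′} (eq ∘ there) = refl

exprCoeff-∩ : ∀ (E : LDE n) S → exprCoeff E (S ∩ vars E) ≡ exprCoeff E S
exprCoeff-∩ E S = exprCoeff-cong E (lookup-∩-∈ S)

coeff-eval : ∀ (E : LDE n) → WellFormed E → ∀ {S} → S ⊆ˢ vars E → coeff (eval E) (monoOf S) ≡ exprCoeff E S
coeff-eval (const k) (const _) S⊆[] = coeff-one k S⊆[]
coeff-eval (mul a b) (mul wa wb a#b) {S} S⊆ = begin
  coeff (polyMul (eval a) (eval b)) (monoOf S)
    ≡⟨ coeff-polyMul-monoOf (eval-supported a) (eval-supported b) a#b S⊆ ⟩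
  coeff (eval a) (monoOf (S ∩ vars a)) * coeff (eval b) (monoOf (S ∩ vars b))
    ≡⟨ cong₂ _*_ (coeff-eval a wa (∩-⊆ˢ S (vars a))) (coeff-eval b wb (∩-⊆ˢ S (vars b))) ⟩
  exprCoeff a (S ∩ vars a) * exprCoeff b (S ∩ vars b)
    ≡⟨ cong₂ _*_ (exprCoeff-∩ a S) (exprCoeff-∩ b S) ⟩
  exprCoeff a S * exprCoeff b S ∎
  where open ≡-Reasoning
coeff-eval (lin e x c) (lin we x∉e _) {S} S⊆ = begin
  coeff (polyMul (eval e) X ++ [ (c , one) ]) (monoOf S)
    ≡⟨ coeff-++ (polyMul (eval e) X) [ (c , one) ] (monoOf S) ⟩
  coeff (polyMul (eval e) X) (monoOf S) + coeff [ (c , one) ] (monoOf S)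
    ≡⟨ cong₂ _+_ (coeff-polyMul-monoOf (eval-supported e) (varMono-supported x ∷ []) e#x S⊆′)
                 (coeff-one c S⊆) ⟩
  coeff (eval e) (monoOf (S ∩ vars e)) * coeff X (monoOf (S ∩ [ x ])) + constant
    ≡⟨ cong₂ (λ g v → g * v + constant) (coeff-eval e we (∩-⊆ˢ S (vars e))) (coeff-varMono S x) ⟩
  exprCoeff e (S ∩ vars e) * (if lookup S x then 1 else 0) + constant
    ≡⟨ cong (λ g → g * (if lookup S x then 1 else 0) + constant) (exprCoeff-∩ e S) ⟩
  exprCoeff e S * (if lookup S x then 1 else 0) + constant
    ≡⟨ select (exprCoeff e S) (lookup S x) ⟩
  exprCoeff (lin e x c) S ∎
  where
  open ≡-Reasoning
  X = [ (1 , varMono x) ]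
  constant = if lookup S x ∨ any (lookup S) (vars e) then 0 else c
  e#x : Disjoint (vars e) [ x ]
  e#x y y∈e (here refl) = x∉e y∈e
  S⊆′ : S ⊆ˢ (vars e ++ [ x ])
  S⊆′ y = Any.++-comm [ x ] (vars e) ∘ S⊆ y
  select : ∀ g b → g * (if b then 1 else 0) + (if b ∨ any (lookup S) (vars e) then 0 else c)
                     ≡ (if b then g else (if any (lookup S) (vars e) then 0 else c))
  select g true  = trans (+-identityʳ _) (*-identityʳ g)
  select g false = cong (_+ (if any (lookup S) (vars e) then 0 else c)) (*-zeroʳ g)

-- S ∪ {v₀} spans a subtree of tree E containing the root; lin∉ excludes the vertex of x and all below it.
data Rooted (S : Subset n) : LDE n → Set where
  const : ∀ {k} → Rooted S (const k)
  mul   : ∀ {a b} → Rooted S a → Rooted S b → Rooted S (mul a b)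
  lin∈  : ∀ {e x c} → lookup S x ≡ true → Rooted S e → Rooted S (lin e x c)
  lin∉  : ∀ {e x c} → lookup S x ≡ false → (∀ {y} → y ∈ vars e → lookup S y ≡ false) →
          Rooted S (lin e x c)

exprCoeff≢0⇒rooted : ∀ (E : LDE n) {S} → exprCoeff E S ≢ 0 → Rooted S E
exprCoeff≢0⇒rooted (const k) _ = const
exprCoeff≢0⇒rooted (mul a b) {S} ≢0 =
  mul (exprCoeff≢0⇒rooted a λ a≡0 → ≢0 (cong (_* exprCoeff b S) a≡0))
      (exprCoeff≢0⇒rooted b λ b≡0 → ≢0 (trans (cong (exprCoeff a S *_) b≡0) (*-zeroʳ (exprCoeff a S))))
exprCoeff≢0⇒rooted (lin e x c) {S} ≢0 with lookup S x in Sx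
... | true  = lin∈ Sx (exprCoeff≢0⇒rooted e ≢0)
... | false with any (lookup S) (vars e) in hit
...   | true  = contradiction refl ≢0
...   | false = lin∉ Sx (any-false⁻ (lookup S) hit)

rooted⇒exprCoeff≢0 : ∀ (E : LDE n) {S} → WellFormed E → Rooted S E → exprCoeff E S ≢ 0
rooted⇒exprCoeff≢0 (const k)   (const 1≤k)   const       = n>0⇒n≢0 1≤k
rooted⇒exprCoeff≢0 (mul a b)   (mul wa wb _) (mul ra rb) =
  [ rooted⇒exprCoeff≢0 a wa ra , rooted⇒exprCoeff≢0 b wb rb ]′ ∘ m*n≡0⇒m≡0∨n≡0 _
rooted⇒exprCoeff≢0 (lin e x c) (lin we _ _)  (lin∈ Sx re) rewrite Sx = rooted⇒exprCoeff≢0 e we re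
rooted⇒exprCoeff≢0 (lin e x c) {S} (lin _ _ 1≤c) (lin∉ Sx miss)
  rewrite Sx | any-false⁺ (lookup S) {vars e} miss = n>0⇒n≢0 1≤c

vertexWeight : Subset n → List (Vertex n × ℕ) → ℕ
vertexWeight S vs = product (map proj₂ (filterᵇ (λ p → inU S (proj₁ p)) vs))

edgeWeight : Subset n → List (Edge n) → ℕ
edgeWeight S es =
  product (map (λ e → proj₁ (proj₂ e)) (filterᵇ (λ e → inU S (proj₁ e) xor inU S (proj₂ (proj₂ e))) es))

-- coeffFormula T S unfolds to weight S nothing T.
weight : Subset n → Vertex n → Tree n → ℕ
weight S r t = vertexWeight S (vertsT r t) * edgeWeight S (edgesT r t)

product-map-filterᵇ-++ : ∀ {A : Set} (g : A → ℕ) (p : A → Bool) xs ys →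
  product (map g (filterᵇ p (xs ++ ys))) ≡ product (map g (filterᵇ p xs)) * product (map g (filterᵇ p ys))
product-map-filterᵇ-++ g p xs ys = begin
  product (map g (filterᵇ p (xs ++ ys)))
    ≡⟨ cong (product ∘ map g) (filter-++ (T? ∘ p) xs ys) ⟩
  product (map g (filterᵇ p xs ++ filterᵇ p ys))
    ≡⟨ cong product (map-++ g (filterᵇ p xs) (filterᵇ p ys)) ⟩
  product (map g (filterᵇ p xs) ++ map g (filterᵇ p ys))
    ≡⟨ product-++ (map g (filterᵇ p xs)) (map g (filterᵇ p ys)) ⟩
  product (map g (filterᵇ p xs)) * product (map g (filterᵇ p ys)) ∎
  where open ≡-Reasoning

Children : ℕ → Set
Children n = List (ℕ × Fin n × Tree n)

vertsL-++ : ∀ (cs ds : Children n) → vertsL (cs ++ ds) ≡ vertsL cs ++ vertsL ds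
vertsL-++ []                ds = refl
vertsL-++ ((c , x , t) ∷ cs) ds =
  trans (cong (vertsT (just x) t ++_) (vertsL-++ cs ds))
        (sym (++-assoc (vertsT (just x) t) (vertsL cs) (vertsL ds)))

edgesL-++ : ∀ (r : Vertex n) (cs ds : Children n) → edgesL r (cs ++ ds) ≡ edgesL r cs ++ edgesL r ds
edgesL-++ r []                ds = refl
edgesL-++ r ((c , x , t) ∷ cs) ds = cong ((r , c , just x) ∷_)
  (trans (cong (edgesT (just x) t ++_) (edgesL-++ r cs ds))
         (sym (++-assoc (edgesT (just x) t) (edgesL r cs) (edgesL r ds))))

edgesT-merge : ∀ (r : Vertex n) t u → edgesT r (merge t u) ≡ edgesT r t ++ edgesT r u
edgesT-merge r (node k cs) (node l ds) = edgesL-++ r cs ds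

vertexWeight-vertsL-++ : ∀ (S : Subset n) cs ds →
  vertexWeight S (vertsL (cs ++ ds)) ≡ vertexWeight S (vertsL cs) * vertexWeight S (vertsL ds)
vertexWeight-vertsL-++ S cs ds =
  trans (cong (vertexWeight S) (vertsL-++ cs ds)) (product-map-filterᵇ-++ _ _ (vertsL cs) (vertsL ds))

vertexWeight-merge : ∀ (S : Subset n) r t u →
  vertexWeight S (vertsT r (merge t u)) ≡ vertexWeight S (vertsT r t) * vertexWeight S (vertsT r u)
vertexWeight-merge S r (node k cs) (node l ds) with inU S r
... | true  = trans (cong (k * l *_) (vertexWeight-vertsL-++ S cs ds)) (interchange k l _ _)
... | false = vertexWeight-vertsL-++ S cs ds

edgeWeight-merge : ∀ (S : Subset n) r t u →
  edgeWeight S (edgesT r (merge t u)) ≡ edgeWeight S (edgesT r t) * edgeWeight S (edgesT r u)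
edgeWeight-merge S r t u =
  trans (cong (edgeWeight S) (edgesT-merge r t u)) (product-map-filterᵇ-++ _ _ (edgesT r t) (edgesT r u))

weight-merge : ∀ (S : Subset n) r t u → weight S r (merge t u) ≡ weight S r t * weight S r u
weight-merge S r t u =
  trans (cong₂ _*_ (vertexWeight-merge S r t u) (edgeWeight-merge S r t u))
        (interchange (vertexWeight S (vertsT r t)) (vertexWeight S (vertsT r u)) _ _)

weight-const : ∀ (S : Subset n) r k → weight S r (node k []) ≡ (if inU S r then k else 1)
weight-const S r k with inU S r
... | true  = trans (*-identityʳ (k * 1)) (*-identityʳ k)
... | false = refl

weight-lin : ∀ (S : Subset n) r c x t →
  weight S r (node 1 [ (c , x , t) ]) ≡ (if inU S r xor lookup S x then c else 1) * weight S (just x) t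
weight-lin S r c x t =
  trans (cong₂ _*_ vertex-part edge-part)
        (x∙yz≈y∙xz (vertexWeight S (vertsT (just x) t)) label (edgeWeight S (edgesT (just x) t)))
  where
  label = if inU S r xor lookup S x then c else 1
  vertex-part : vertexWeight S (vertsT r (node 1 [ (c , x , t) ])) ≡ vertexWeight S (vertsT (just x) t)
  vertex-part with inU S r
  ... | true  = trans (*-identityˡ _) (cong (vertexWeight S) (++-identityʳ (vertsT (just x) t)))
  ... | false = cong (vertexWeight S) (++-identityʳ (vertsT (just x) t))
  edge-part : edgeWeight S (edgesT r (node 1 [ (c , x , t) ])) ≡ label * edgeWeight S (edgesT (just x) t)
  edge-part with inU S r xor lookup S x
  ... | true  = cong (c *_) (cong (edgeWeight S) (++-identityʳ (edgesT (just x) t)))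
  ... | false = trans (cong (edgeWeight S) (++-identityʳ (edgesT (just x) t))) (sym (*-identityˡ _))

weight-outside : ∀ (E : LDE n) {S r} → inU S r ≡ false → (∀ {y} → y ∈ vars E → lookup S y ≡ false) →
                 weight S r (tree E) ≡ 1
weight-outside (const k)   {S} {r} Sr miss = trans (weight-const S r k) (cong (λ b → if b then k else 1) Sr)
weight-outside (mul a b)   {S} {r} Sr miss = trans (weight-merge S r (tree a) (tree b))
  (cong₂ _*_ (weight-outside a Sr (miss ∘ ∈-++⁺ˡ)) (weight-outside b Sr (miss ∘ ∈-++⁺ʳ (vars a))))
weight-outside (lin e x c) {S} {r} Sr miss rewrite weight-lin S r c x (tree e) | Sr | miss (here refl) =
  trans (*-identityˡ _) (weight-outside e (miss (here refl)) (miss ∘ there))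

weight-rooted : ∀ (E : LDE n) {S r} → inU S r ≡ true → Rooted S E → weight S r (tree E) ≡ exprCoeff E S
weight-rooted (const k)   {S} {r} Sr const = trans (weight-const S r k) (cong (λ b → if b then k else 1) Sr)
weight-rooted (mul a b)   {S} {r} Sr (mul ra rb) =
  trans (weight-merge S r (tree a) (tree b)) (cong₂ _*_ (weight-rooted a Sr ra) (weight-rooted b Sr rb))
weight-rooted (lin e x c) {S} {r} Sr (lin∈ Sx re) rewrite weight-lin S r c x (tree e) | Sr | Sx =
  trans (*-identityˡ _) (weight-rooted e Sx re)
weight-rooted (lin e x c) {S} {r} Sr (lin∉ Sx miss)
  rewrite weight-lin S r c x (tree e) | Sr | Sx | any-false⁺ (lookup S) {vars e} miss =
  trans (cong (c *_) (weight-outside e Sx miss)) (*-identityʳ c)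

Adj-sym : ∀ {T : Tree n} {u v} → Adj T u v → Adj T v u
Adj-sym (c , inj₁ uv) = c , inj₂ uv
Adj-sym (c , inj₂ vu) = c , inj₁ vu

_++ᵂ_ : ∀ {T : Tree n} {S u v w} → Walk T S u v → Walk T S v w → Walk T S u w
done        ++ᵂ q = q
step a Sv p ++ᵂ q = step a Sv (p ++ᵂ q)

reverseᵂ : ∀ {T : Tree n} {S u v} → inU S u ≡ true → Walk T S u v → Walk T S v u
reverseᵂ         Su done          = done
reverseᵂ {T = T} Su (step a Sv p) = reverseᵂ Sv p ++ᵂ step (Adj-sym {T = T} a) Su done

walk-crossing : ∀ {T : Tree n} {S} {P : Vertex n → Set} → Decidable P →
                ∀ {u w} → Walk T S u w → ¬ P u → P w →
                ∃₂ λ u′ v → Adj T u′ v × ¬ P u′ × P v × inU S v ≡ true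
walk-crossing P? done ¬Pu Pw = contradiction Pw ¬Pu
walk-crossing P? {u} (step {v = v} a Sv p) ¬Pu Pw with P? v
... | yes Pv  = u , v , a , ¬Pu , Pv , Sv
... | no ¬Pv = walk-crossing P? p ¬Pv Pw

Inner : List (Fin n) → Vertex n → Set
Inner A nothing  = ⊥
Inner A (just z) = z ∈ A

inner? : ∀ (A : List (Fin n)) → Decidable (Inner A)
inner? A nothing  = no λ ()
inner? A (just z) = z ∈? A

Inner-mono : ∀ {A B : List (Fin n)} {v} → A ⊆ B → Inner A v → Inner B v
Inner-mono {v = just z} A⊆B z∈A = A⊆B z∈A

OnTree : Vertex n → List (Fin n) → Vertex n → Set
OnTree r A v = v ≡ r ⊎ Inner A v

OnTree-mono : ∀ {r : Vertex n} {A B v} → A ⊆ B → OnTree r A v → OnTree r B v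
OnTree-mono {v = v} A⊆B = map₂ (Inner-mono {v = v} A⊆B)

OnTree-lin : ∀ {x : Fin n} {A v} → OnTree (just x) A v → Inner (x ∷ A) v
OnTree-lin              (inj₁ refl) = here refl
OnTree-lin {v = just z} (inj₂ z∈A)  = there z∈A

OnTree-disjoint : ∀ {r : Vertex n} {A B w} → ¬ Inner A r → Disjoint A B → OnTree r B w → ¬ Inner A w
OnTree-disjoint              r∉A A#B (inj₁ refl)     = r∉A
OnTree-disjoint {w = just z} r∉A A#B (inj₂ z∈B) z∈A = A#B z z∈A z∈B

∈-edgesT-merge⁻ : ∀ {r : Vertex n} {t u e} → e ∈ edgesT r (merge t u) → e ∈ edgesT r t ⊎ e ∈ edgesT r u
∈-edgesT-merge⁻ {r = r} {t} {u} e∈ = ∈-++⁻ (edgesT r t) (subst (_ ∈_) (edgesT-merge r t u) e∈)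

∈-edgesT-merge⁺ˡ : ∀ {r : Vertex n} {t u} → edgesT r t ⊆ edgesT r (merge t u)
∈-edgesT-merge⁺ˡ {r = r} {t} {u} = subst (_ ∈_) (sym (edgesT-merge r t u)) ∘ ∈-++⁺ˡ

∈-edgesT-merge⁺ʳ : ∀ {r : Vertex n} {t u} → edgesT r u ⊆ edgesT r (merge t u)
∈-edgesT-merge⁺ʳ {r = r} {t} {u} = subst (_ ∈_) (sym (edgesT-merge r t u)) ∘ ∈-++⁺ʳ (edgesT r t)

∈-edgesT-lin⁻ : ∀ {r : Vertex n} {x c t e} → e ∈ edgesT r (node 1 [ (c , x , t) ]) →
                e ≡ (r , c , just x) ⊎ e ∈ edgesT (just x) t
∈-edgesT-lin⁻ (here refl) = inj₁ refl
∈-edgesT-lin⁻ {x = x} {t = t} (there e∈) with ∈-++⁻ (edgesT (just x) t) e∈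
... | inj₁ e∈t = inj₂ e∈t
... | inj₂ ()

edgesT-endpoints : ∀ (E : LDE n) {r u c v} → (u , c , v) ∈ edgesT r (tree E) →
                   OnTree r (vars E) u × OnTree r (vars E) v
edgesT-endpoints (mul a b) e∈ with ∈-edgesT-merge⁻ {t = tree a} {tree b} e∈
... | inj₁ e∈a = let (pu , pv) = edgesT-endpoints a e∈a in
  OnTree-mono ∈-++⁺ˡ pu , OnTree-mono ∈-++⁺ˡ pv
... | inj₂ e∈b = let (pu , pv) = edgesT-endpoints b e∈b in
  OnTree-mono (∈-++⁺ʳ (vars a)) pu , OnTree-mono (∈-++⁺ʳ (vars a)) pv
edgesT-endpoints (lin e x c) e∈ with ∈-edgesT-lin⁻ {x = x} {c} {tree e} e∈
... | inj₁ refl = inj₁ refl , inj₂ (here refl)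
... | inj₂ e∈e  = let (pu , pv) = edgesT-endpoints e e∈e in inj₂ (OnTree-lin pu) , inj₂ (OnTree-lin pv)

rooted⇒walk : ∀ {T : Tree n} {S} (E : LDE n) {r} → edgesT r (tree E) ⊆ edges T → Rooted S E →
              ∀ {y} → y ∈ vars E → lookup S y ≡ true → Walk T S r (just y)
rooted⇒walk (mul a b) E⊆T (mul ra rb) y∈ Sy with ∈-++⁻ (vars a) y∈
... | inj₁ y∈a = rooted⇒walk a (E⊆T ∘ ∈-edgesT-merge⁺ˡ {t = tree a} {tree b}) ra y∈a Sy
... | inj₂ y∈b = rooted⇒walk b (E⊆T ∘ ∈-edgesT-merge⁺ʳ {t = tree a} {tree b}) rb y∈b Sy
rooted⇒walk (lin e x c) E⊆T ρ (here refl) Sx = step (c , inj₁ (E⊆T (here refl))) Sx done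
rooted⇒walk (lin e x c) E⊆T (lin∈ Sx re) (there y∈e) Sy =
  step (c , inj₁ (E⊆T (here refl))) Sx (rooted⇒walk e (E⊆T ∘ there ∘ ∈-++⁺ˡ) re y∈e Sy)
rooted⇒walk (lin e x c) E⊆T (lin∉ _ miss) (there y∈e) Sy =
  contradiction (trans (sym Sy) (miss y∈e)) λ ()

record Pendant (T : Tree n) (A : List (Fin n)) (es : List (Edge n)) : Set where
  constructor pendant
  field touching-∈ : ∀ {u c v} → (u , c , v) ∈ edges T → Inner A u ⊎ Inner A v → (u , c , v) ∈ es
open Pendant

pendant-++ˡ : ∀ {T : Tree n} {r A B es fs} → Pendant T (A ++ B) (es ++ fs) →
  (∀ {u c v} → (u , c , v) ∈ fs → OnTree r B u × OnTree r B v) → ¬ Inner A r → Disjoint A B →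
  Pendant T A es
pendant-++ˡ {T = T} {r} {A} {B} {es} pend fs-on-B r∉A A#B = pendant restrict
  where
  restrict : ∀ {u c v} → (u , c , v) ∈ edges T → Inner A u ⊎ Inner A v → (u , c , v) ∈ es
  restrict e∈T touches
    with ∈-++⁻ es (touching-∈ pend e∈T (map-⊎ (Inner-mono ∈-++⁺ˡ) (Inner-mono ∈-++⁺ˡ) touches))
  ... | inj₁ e∈es = e∈es
  ... | inj₂ e∈fs with fs-on-B e∈fs | touches
  ...   | on-u , _ | inj₁ u∈A = ⊥-elim (OnTree-disjoint r∉A A#B on-u u∈A)
  ...   | _ , on-v | inj₂ v∈A = ⊥-elim (OnTree-disjoint r∉A A#B on-v v∈A)

pendant-++ʳ : ∀ {T : Tree n} {r A B es fs} → Pendant T (A ++ B) (es ++ fs) →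
  (∀ {u c v} → (u , c , v) ∈ es → OnTree r A u × OnTree r A v) → ¬ Inner B r → Disjoint B A →
  Pendant T B fs
pendant-++ʳ {T = T} {A = A} {B} {es} {fs} pend = pendant-++ˡ {es = fs} {es} (pendant swapped)
  where
  swapped : ∀ {u c v} → (u , c , v) ∈ edges T → Inner (B ++ A) u ⊎ Inner (B ++ A) v → (u , c , v) ∈ fs ++ es
  swapped e∈T touches = Any.++-comm es fs
    (touching-∈ pend e∈T (map-⊎ (Inner-mono (Any.++-comm B A)) (Inner-mono (Any.++-comm B A)) touches))

walks⇒rooted : ∀ {T : Tree n} {S} (E : LDE n) {r} → WellFormed E → ¬ Inner (vars E) r →
               Pendant T (vars E) (edgesT r (tree E)) →
               (∀ {y} → y ∈ vars E → lookup S y ≡ true → Walk T S nothing (just y)) → Rooted S E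
walks⇒rooted (const k) _ _ _ _ = const
walks⇒rooted {T = T} (mul a b) {r} (mul wa wb a#b) r∉ pend walks =
  mul (walks⇒rooted a wa r∉a pendant-a (walks ∘ ∈-++⁺ˡ))
      (walks⇒rooted b wb r∉b pendant-b (walks ∘ ∈-++⁺ʳ (vars a)))
  where
  r∉a : ¬ Inner (vars a) r
  r∉a = r∉ ∘ Inner-mono {v = r} ∈-++⁺ˡ
  r∉b : ¬ Inner (vars b) r
  r∉b = r∉ ∘ Inner-mono {v = r} (∈-++⁺ʳ (vars a))
  split : Pendant T (vars a ++ vars b) (edgesT r (tree a) ++ edgesT r (tree b))
  split = subst (Pendant T _) (edgesT-merge r (tree a) (tree b)) pend
  pendant-a : Pendant T (vars a) (edgesT r (tree a))
  pendant-a = pendant-++ˡ {fs = edgesT r (tree b)} split (edgesT-endpoints b) r∉a a#b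
  pendant-b : Pendant T (vars b) (edgesT r (tree b))
  pendant-b = pendant-++ʳ {es = edgesT r (tree a)} split (edgesT-endpoints a) r∉b (Disjoint-sym a#b)
walks⇒rooted {T = T} {S} (lin e x c) {r} (lin we x∉e _) r∉ pend walks with lookup S x in Sx
... | true  = lin∈ Sx (walks⇒rooted e we x∉e pendant-e (walks ∘ there))
  where
  pendant-e : Pendant T (vars e) (edgesT (just x) (tree e))
  pendant-e = subst (Pendant T (vars e)) (++-identityʳ _)
    (pendant-++ʳ {A = [ x ]} {es = [ (r , c , just x) ]} pend
       (λ { (here refl) → inj₁ refl , inj₂ (here refl) }) (r∉ ∘ Inner-mono {v = r} there)
       λ { y y∈e (here refl) → x∉e y∈e })
... | false = lin∉ Sx λ y∈e → ¬-not (blocked y∈e)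
  where
  -- A walk from the root into the subtree of x has to enter it along the edge r — x, but x ∉ S.
  blocked : ∀ {y} → y ∈ vars e → lookup S y ≢ true
  blocked y∈e Sy with walk-crossing (inner? (x ∷ vars e)) (walks (there y∈e) Sy) (λ ()) (there y∈e)
  ... | u′ , v , (c′ , inj₁ uv) , out , inside , Sv
    with ∈-edgesT-lin⁻ {x = x} {c} {tree e} (touching-∈ pend uv (inj₂ inside))
  ...   | inj₁ refl = contradiction (trans (sym Sv) Sx) λ ()
  ...   | inj₂ e∈e  = out (OnTree-lin (proj₁ (edgesT-endpoints e e∈e)))
  blocked y∈e Sy | u′ , v , (c′ , inj₂ vu) , out , inside , Sv
    with ∈-edgesT-lin⁻ {x = x} {c} {tree e} (touching-∈ pend vu (inj₁ inside))
  ...   | inj₁ refl = out (here refl)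
  ...   | inj₂ e∈e  = out (OnTree-lin (proj₂ (edgesT-endpoints e e∈e)))

connected⇒rooted : ∀ (E : LDE n) {S} → WellFormed E → InducedConnected (tree E) S → Rooted S E
connected⇒rooted E wf conn =
  walks⇒rooted E wf (λ ()) (pendant λ e∈ _ → e∈) (λ {y} _ Sy → conn nothing (just y) refl Sy)

rooted⇒connected : ∀ (E : LDE n) {S} → S ⊆ˢ vars E → Rooted S E → InducedConnected (tree E) S
rooted⇒connected E {S} S⊆E ρ u v Su Sv = reverseᵂ refl (from-root u Su) ++ᵂ from-root v Sv
  where
  from-root : ∀ w → inU S w ≡ true → Walk (tree E) S nothing w
  from-root nothing  _  = done
  from-root (just y) Sy = rooted⇒walk E (λ e∈ → e∈) ρ (S⊆E y Sy) Sy

proposition3p14 : ∀ {n} (E : LDE n) → WellFormed E →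
    (S : Subset n) → (∀ x → lookup S x ≡ true → x ∈ vars E) →
    ((coeff (eval E) (monoOf S) ≢ 0 → InducedConnected (tree E) S)
     × (InducedConnected (tree E) S → coeff (eval E) (monoOf S) ≢ 0))
    × (InducedConnected (tree E) S →
       coeff (eval E) (monoOf S) ≡ coeffFormula (tree E) S)
proposition3p14 E wf S S⊆E = (nonzero⇒connected , connected⇒nonzero) , connected⇒formula
  where
  coeff≡ : coeff (eval E) (monoOf S) ≡ exprCoeff E S
  coeff≡ = coeff-eval E wf S⊆E
  nonzero⇒connected : coeff (eval E) (monoOf S) ≢ 0 → InducedConnected (tree E) S
  nonzero⇒connected ≢0 = rooted⇒connected E S⊆E (exprCoeff≢0⇒rooted E (≢0 ∘ trans coeff≡))
  connected⇒nonzero : InducedConnected (tree E) S → coeff (eval E) (monoOf S) ≢ 0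
  connected⇒nonzero conn = rooted⇒exprCoeff≢0 E wf (connected⇒rooted E wf conn) ∘ trans (sym coeff≡)
  connected⇒formula : InducedConnected (tree E) S → coeff (eval E) (monoOf S) ≡ coeffFormula (tree E) S
  connected⇒formula conn = trans coeff≡ (sym (weight-rooted E refl (connected⇒rooted E wf conn)))
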